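{- Let $\mathcal E$ be an exchangeability system for a noncommutative probability space $(\mathcal A,\phi)$, let $X_1,\dots,X_n\in\mathcal A$ and $I\subseteq\{1,\dots,n\}$ with $X_j=1$ (the unit) for all $j\in I$. Let $\pi\in\Pi_n$ have a singleton block $\{j\}$ for each $j\in I$ (and possibly other singletons), and let $\tilde\pi$ be the partition of $\{1,\dots,n\}\setminus I$ obtained by removing these singletons from $\pi$. Then $$K_\pi(X_1,\dots,X_n)=K_{\tilde\pi}\bigl(X_i:i\in\{1,\dots,n\}\setminus I\bigr).$$
   Context: A noncommutative probability space is a pair $(\mathcal A,\phi)$ of a complex unital algebra $\mathcal A$ and a unital linear functional $\phi$. An exchangeability system $\mathcal E$ for $(\mathcal A,\phi)$ consists of a noncommutative probability space $(\mathcal U,\tilde\phi)$ and embeddings (injective unital homomorphisms) $\iota_k:\mathcal A\to\mathcal U$, $k\in\mathbb N$, with $\tilde\phi\circ\iota_k=\phi$; write $X^{(k)}=\iota_k(X)$. It is required that for all $n$, all $X_1,\dots,X_n\in\mathcal A$, all indices $i_1,\dots,i_n\in\mathbb N$ and every permutation $\sigma$ of $\mathbb N$: $\tilde\phi(X_1^{(i_1)}\cdots X_n^{(i_n)})=\tilde\phi(X_1^{(\sigma(i_1))}\cdots X_n^{(\sigma(i_n))})$. Thus this value depends only on the kernel of $j\mapsto i_j$; for a partition $\sigma$ of $[n]$ denote it $\phi_\sigma(X_1,\dots,X_n)$, and for a partition of a subset $S\subseteq[n]$ the same notation applies to the subsequence $(X_i)_{i\in S}$ in increasing order. $\Pi_n$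 is the lattice of set partitions of $[n]$ under refinement with Möbius function $\mu$; the partitioned cumulant is $K_\pi=\sum_{\sigma\le\pi}\phi_\sigma\mu(\sigma,\pi)$. -}

module Defs where

open import Level using (Level; _⊔_) renaming (suc to lsuc)
open import Algebra.Bundles using (CommutativeRing; Ring)
open import Algebra.Morphism.Structures using (IsRingMonomorphism)
open import Data.Nat using (ℕ; zero; suc; _≡ᵇ_)
open import Data.Bool using (Bool; true; false; _∧_; _∨_; not; if_then_else_)
open import Data.Fin using (Fin) renaming (zero to fzero; suc to fsuc)
open import Data.Vec using (Vec; []; _∷_; lookup)
open import Data.List using (List; []; _∷_; map; concatMap; upTo; allFin; filter; foldr)
open import Function.Bundles using (_↔_; Inverse)
open import Relation.Binary.PropositionalEquality using (_≡_)

-- Unital associative algebras over a commutative ring of scalars R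
-- (the paper uses R = ℂ; ℂ is not available in agda-stdlib).

record UnitalAlgebra {r ℓr : Level} (R : CommutativeRing r ℓr) (a ℓa : Level)
       : Set (r ⊔ ℓr ⊔ lsuc (a ⊔ ℓa)) where
  private module R = CommutativeRing R
  field
    ring : Ring a ℓa
  open Ring ring public
  infixr 7 _·_
  field
    _·_        : R.Carrier → Carrier → Carrier
    ·-cong     : ∀ {s t x y} → s R.≈ t → x ≈ y → s · x ≈ t · y
    ·-distribˡ : ∀ s x y → s · (x + y) ≈ s · x + s · y
    ·-distribʳ : ∀ s t x → (s R.+ t) · x ≈ s · x + t · x
    ·-assoc    : ∀ s t x → (s R.* t) · x ≈ s · (t · x)
    ·-identity : ∀ x → R.1# · x ≈ x
    ·-*-assocˡ : ∀ s x y → (s · x) * y ≈ s · (x * y)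
    ·-*-assocʳ : ∀ s x y → x * (s · y) ≈ s · (x * y)

module _ {r ℓr : Level} {R : CommutativeRing r ℓr} where
  private module R = CommutativeRing R

  record IsUnitalLinearFunctional {a ℓa} (A : UnitalAlgebra R a ℓa)
         (f : UnitalAlgebra.Carrier A → R.Carrier) : Set (r ⊔ ℓr ⊔ a ⊔ ℓa) where
    private module A = UnitalAlgebra A
    field
      cong    : ∀ {x y} → x A.≈ y → f x R.≈ f y
      additive : ∀ x y → f (x A.+ y) R.≈ f x R.+ f y
      homogeneous : ∀ s x → f (s A.· x) R.≈ s R.* f x
      unital  : f A.1# R.≈ R.1#

  record NCProbabilitySpace (a ℓa : Level) : Set (r ⊔ ℓr ⊔ lsuc (a ⊔ ℓa)) where
    field
      algebra : UnitalAlgebra R a ℓa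
      φ       : UnitalAlgebra.Carrier algebra → R.Carrier
      φ-isUnitalLinearFunctional : IsUnitalLinearFunctional algebra φ

  record IsEmbedding {a ℓa b ℓb} (A : UnitalAlgebra R a ℓa) (B : UnitalAlgebra R b ℓb)
         (h : UnitalAlgebra.Carrier A → UnitalAlgebra.Carrier B) : Set (r ⊔ a ⊔ ℓa ⊔ ℓb) where
    private
      module A = UnitalAlgebra A
      module B = UnitalAlgebra B
    field
      isRingMonomorphism : IsRingMonomorphism A.rawRing B.rawRing h
      linear : ∀ s x → h (s A.· x) B.≈ s B.· h x

  prod : ∀ {a ℓa} (A : UnitalAlgebra R a ℓa) (n : ℕ) →
         (Fin n → UnitalAlgebra.Carrier A) → UnitalAlgebra.Carrier A
  prod A zero    x = UnitalAlgebra.1# A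
  prod A (suc n) x = UnitalAlgebra._*_ A (x fzero) (prod A n (λ j → x (fsuc j)))

  record ExchangeabilitySystem {a ℓa} (P : NCProbabilitySpace a ℓa) (u ℓu : Level)
         : Set (r ⊔ ℓr ⊔ lsuc (a ⊔ ℓa ⊔ u ⊔ ℓu)) where
    open NCProbabilitySpace P
    private module A = UnitalAlgebra algebra
    field
      𝒰   : UnitalAlgebra R u ℓu
      φ̃   : UnitalAlgebra.Carrier 𝒰 → R.Carrier
      φ̃-isUnitalLinearFunctional : IsUnitalLinearFunctional 𝒰 φ̃
      ι   : ℕ → A.Carrier → UnitalAlgebra.Carrier 𝒰
      ι-isEmbedding : ∀ k → IsEmbedding algebra 𝒰 (ι k)
      φ̃∘ι : ∀ k x → φ̃ (ι k x) R.≈ φ x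
      exchangeable : ∀ (n : ℕ) (X : Fin n → A.Carrier) (i : Fin n → ℕ) (σ : ℕ ↔ ℕ) →
        φ̃ (prod 𝒰 n (λ j → ι (i j) (X j)))
          R.≈ φ̃ (prod 𝒰 n (λ j → ι (Inverse.to σ (i j)) (X j)))

-- Set partitions of [n] = Fin n, represented canonically as restricted
-- growth strings: π : Vec ℕ n, lookup π j = label of the block of j,
-- blocks labelled 0,1,2,... in order of their smallest element.

-- all restricted growth strings of length k when m labels are already used
rgs : (k m : ℕ) → List (Vec ℕ k)
rgs zero    m = [] ∷ []
rgs (suc k) m = concatMap (λ a → map (a ∷_) (rgs k (if a ≡ᵇ m then suc m else m))) (upTo (suc m))

Π : (n : ℕ) → List (Vec ℕ n)
Π n = rgs n 0

allᵇ : {A : Set} → (A → Bool) → List A → Bool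
allᵇ p = foldr (λ x b → p x ∧ b) true

_≤ᵖ_ : ∀ {n} → Vec ℕ n → Vec ℕ n → Bool
_≤ᵖ_ {n} σ π = allᵇ (λ i → allᵇ (λ j → not (lookup σ i ≡ᵇ lookup σ j) ∨ (lookup π i ≡ᵇ lookup π j)) (allFin n)) (allFin n)

_=ᵖ_ : ∀ {n} → Vec ℕ n → Vec ℕ n → Bool
_=ᵖ_ {n} σ π = allᵇ (λ i → lookup σ i ≡ᵇ lookup π i) (allFin n)

module _ {r ℓr : Level} (R : CommutativeRing r ℓr) where
  open CommutativeRing R

  Σᴿ : List Carrier → Carrier
  Σᴿ = foldr _+_ 0#

  -- The fuel argument only ensures termination;
  -- any chain in Π n has length < n + 1, so fuel (suc n) suffices.
  μ-fuel : ∀ {n} → ℕ → Vec ℕ n → Vec ℕ n → Carrier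
  μ-fuel zero σ π = 0#
  μ-fuel {n} (suc f) σ π =
    if σ =ᵖ π then 1#
    else if σ ≤ᵖ π
      then - Σᴿ (map (λ τ → μ-fuel f σ τ)
                  (filter (λ τ → Data.Bool._≟_ ((σ ≤ᵖ τ) ∧ (τ ≤ᵖ π) ∧ not (τ =ᵖ π)) true) (Π n)))
      else 0#
    where import Data.Bool

  μ : ∀ {n} → Vec ℕ n → Vec ℕ n → Carrier
  μ {n} = μ-fuel (suc n)

module _ {r ℓr a ℓa u ℓu : Level} {R : CommutativeRing r ℓr}
         {P : NCProbabilitySpace {R = R} a ℓa} (E : ExchangeabilitySystem P u ℓu) where
  open CommutativeRing R
  open ExchangeabilitySystem E
  private module A = UnitalAlgebra (NCProbabilitySpace.algebra P)

  φ[_] : ∀ {n} → Vec ℕ n → (Fin n → A.Carrier) → Carrier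
  φ[_] {n} σ X = φ̃ (prod 𝒰 n (λ j → ι (lookup σ j) (X j)))

  K[_] : ∀ {n} → Vec ℕ n → (Fin n → A.Carrier) → Carrier
  K[_] {n} π X = Σᴿ R (map (λ σ → φ[ σ ] X * μ R σ π)
                          (filter (λ σ → Data.Bool._≟_ (σ ≤ᵖ π) true) (Π n)))
    where import Data.Bool

-- Every j ∈ I is a singleton of π and hence of every σ ≤ π, so deleting the indices in I (and
-- relabelling canonically) is a bijection from the partitions below π onto those below π̃. The
-- bijection and its inverse preserve refinement, so they preserve the Möbius function, which is
-- computed by its recursion over intervals; the fuel of that recursion does not matter once it
-- exceeds the number of points, since each recursive step strictly increases the number of blocks.
-- On the moment side the factors ι(X_j) = 1 with j ∈ I drop out of the product, and
-- exchangeability makes φ̃ depend on the labelling of the remaining factors only through its kernel.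
module Submission where

open import Defs
open import Level using (Level)
open import Algebra.Bundles using (CommutativeRing)
open import Algebra.Morphism.Structures using (IsRingMonomorphism)
open import Data.Nat using (ℕ; zero; suc; _≡ᵇ_)
import Data.Nat as ℕ
import Data.Nat.Properties as ℕ
open import Data.Bool using (Bool; true; false; _∧_; _∨_; not; if_then_else_)
import Data.Bool as Bool
open import Data.Bool.Properties using (T-≡; ⇔→≡)
open import Data.Fin using (Fin; _<_; toℕ; fromℕ<; inject; punchOut) renaming (zero to fzero; suc to fsuc)
import Data.Fin.Properties as Fin
open import Data.Fin.Subset using (Subset; _∈_; _∉_; _⊆_; ∣_∣)
open import Data.Fin.Subset.Properties using (_∈?_; p⊆q⇒∣p∣≤∣q∣; p⊂q⇒∣p∣<∣q∣; ∣p∣≤n)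
open import Data.Vec using (Vec; []; _∷_; lookup; tabulate)
import Data.Vec.Properties as Vec
open import Data.List using (List; []; _∷_; map; upTo; allFin; filter)
import Data.List.Properties as List
open import Data.List.Membership.Propositional using (find; lose) renaming (_∈_ to _∈ˡ_)
open import Data.List.Membership.Propositional.Properties
  using (∈-concatMap⁺; ∈-concatMap⁻; ∈-map⁺; ∈-map⁻; ∈-upTo⁺; ∈-upTo⁻; ∈-allFin; ∈-filter⁺; ∈-filter⁻)
open import Data.List.Membership.Propositional.Properties.WithK using (unique∧set⇒bag)
open import Data.List.Relation.Binary.BagAndSetEquality using (∼bag⇒↭)
open import Data.List.Relation.Binary.Permutation.Propositional using (_↭_; ↭⇒↭ₛ′)
import Data.List.Relation.Binary.Permutation.Propositional.Properties as ↭
open import Data.List.Relation.Binary.Permutation.Setoid.Properties using (foldr-commMonoid)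
open import Data.List.Relation.Unary.Any using (here; there)
import Data.List.Relation.Unary.All as All
import Data.List.Relation.Unary.All.Properties as All
open import Data.List.Relation.Unary.AllPairs as AllPairs using ([]; _∷_)
import Data.List.Relation.Unary.AllPairs.Properties as AllPairs
open import Data.List.Relation.Unary.Unique.Propositional using (Unique)
import Data.List.Relation.Unary.Unique.Propositional.Properties as Unique
open import Data.Product using (∃; ∃₂; _×_; _,_; proj₁; proj₂)
open import Data.Sum using (inj₁; inj₂)
open import Data.Empty using (⊥-elim)
open import Function using (_∘_; id)
open import Function.Bundles using (_↔_; _⇔_; mk⇔; mk↔ₛ′; Equivalence; Inverse)
open import Function.Properties.Equivalence using () renaming (refl to ⇔-refl; sym to ⇔-sym; trans to ⇔-trans)
open import Function.Properties.Inverse using (↔-trans)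
open import Relation.Nullary using (¬_; Dec; yes; no; does)
open import Relation.Nullary.Decidable using (_→-dec_; ¬?; dec-true; decidable-stable)
open import Relation.Binary using (tri<; tri≈; tri>)
open import Relation.Binary.PropositionalEquality
  using (_≡_; _≢_; refl; sym; trans; cong; cong₂; subst; subst₂; module ≡-Reasoning)

private
  variable
    k m n : ℕ

≡ᵇ-true⇔≡ : ∀ {a b} → (a ≡ᵇ b) ≡ true ⇔ a ≡ b
≡ᵇ-true⇔≡ {a} {b} = mk⇔ (ℕ.≡ᵇ⇒≡ a b ∘ Equivalence.from T-≡) (Equivalence.to T-≡ ∘ ℕ.≡⇒≡ᵇ a b)

≢⇒≡ᵇ-false : ∀ {a b} → a ≢ b → (a ≡ᵇ b) ≡ false
≢⇒≡ᵇ-false {a} {b} a≢b with a ≡ᵇ b in eq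
... | true  = ⊥-elim (a≢b (Equivalence.to ≡ᵇ-true⇔≡ eq))
... | false = refl

∧-true⇔ : ∀ {a b} → a ∧ b ≡ true ⇔ (a ≡ true × b ≡ true)
∧-true⇔ {true}  = mk⇔ (refl ,_) proj₂
∧-true⇔ {false} = mk⇔ (λ ()) (λ ())

not-true⇔ : ∀ {a} → not a ≡ true ⇔ a ≡ false
not-true⇔ {false} = mk⇔ (λ _ → refl) (λ _ → refl)
not-true⇔ {true}  = mk⇔ (λ ()) (λ ())

implication-true⇔ : ∀ {b c} → not b ∨ c ≡ true ⇔ (b ≡ true → c ≡ true)
implication-true⇔ {true}  = mk⇔ (λ h _ → h) (λ h → h refl)
implication-true⇔ {false} = mk⇔ (λ _ ()) (λ _ → refl)

allᵇ-true⇔ : ∀ {A : Set} (p : A → Bool) xs → allᵇ p xs ≡ true ⇔ (∀ {x} → x ∈ˡ xs → p x ≡ true)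
allᵇ-true⇔ p xs = mk⇔ (elim xs) (intro xs)
  where
  elim : ∀ xs → allᵇ p xs ≡ true → ∀ {x} → x ∈ˡ xs → p x ≡ true
  elim (y ∷ ys) h (here refl) with p y
  ... | true = refl
  elim (y ∷ ys) h (there x∈) with p y
  ... | true = elim ys h x∈
  intro : ∀ xs → (∀ {x} → x ∈ˡ xs → p x ≡ true) → allᵇ p xs ≡ true
  intro []       h = refl
  intro (y ∷ ys) h with p y | h (here refl)
  ... | true | _ = intro ys (h ∘ there)

allᵇ-allFin-true⇔ : (p : Fin n → Bool) → allᵇ p (allFin n) ≡ true ⇔ (∀ i → p i ≡ true)
allᵇ-allFin-true⇔ {n} p = mk⇔ (λ h i → Equivalence.to (allᵇ-true⇔ p (allFin n)) h (∈-allFin i))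
                              (λ h → Equivalence.from (allᵇ-true⇔ p (allFin n)) (λ {i} _ → h i))

does-true⇒ : ∀ {P : Set} (P? : Dec P) → does P? ≡ true → P
does-true⇒ (yes p) _ = p

≡-sym⇔ : ∀ {A : Set} {x y : A} → (x ≡ y) ⇔ (y ≡ x)
≡-sym⇔ = mk⇔ sym sym

≡-rhs⇔ : ∀ {A : Set} {x y z : A} → y ≡ z → (x ≡ y) ⇔ (x ≡ z)
≡-rhs⇔ refl = ⇔-refl

-- Kernels and refinement

Refines : (Fin k → ℕ) → (Fin k → ℕ) → Set
Refines v w = ∀ i j → v i ≡ v j → w i ≡ w j

SameKernel : (Fin k → ℕ) → (Fin k → ℕ) → Set
SameKernel v w = ∀ i j → (v i ≡ v j) ⇔ (w i ≡ w j)

≤ᵖ-true⇔Refines : (σ π : Vec ℕ n) → σ ≤ᵖ π ≡ true ⇔ Refines (lookup σ) (lookup π)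
≤ᵖ-true⇔Refines {n} σ π = mk⇔ to from
  where
  entry : Fin n → Fin n → Bool
  entry i j = not (lookup σ i ≡ᵇ lookup σ j) ∨ (lookup π i ≡ᵇ lookup π j)
  row : Fin n → Bool
  row i = allᵇ (entry i) (allFin n)
  entry⇔ : ∀ i j → entry i j ≡ true ⇔ (lookup σ i ≡ lookup σ j → lookup π i ≡ lookup π j)
  entry⇔ i j = mk⇔
    (λ h → Equivalence.to ≡ᵇ-true⇔≡ ∘ Equivalence.to implication-true⇔ h ∘ Equivalence.from ≡ᵇ-true⇔≡)
    (λ h → Equivalence.from implication-true⇔ (Equivalence.from ≡ᵇ-true⇔≡ ∘ h ∘ Equivalence.to ≡ᵇ-true⇔≡))
  to : σ ≤ᵖ π ≡ true → Refines (lookup σ) (lookup π)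
  to h i j = Equivalence.to (entry⇔ i j)
    (Equivalence.to (allᵇ-allFin-true⇔ (entry i)) (Equivalence.to (allᵇ-allFin-true⇔ row) h i) j)
  from : Refines (lookup σ) (lookup π) → σ ≤ᵖ π ≡ true
  from h = Equivalence.from (allᵇ-allFin-true⇔ row) λ i →
    Equivalence.from (allᵇ-allFin-true⇔ (entry i)) λ j → Equivalence.from (entry⇔ i j) (h i j)

=ᵖ-true⇔≡ : (σ π : Vec ℕ n) → σ =ᵖ π ≡ true ⇔ σ ≡ π
=ᵖ-true⇔≡ {n} σ π = mk⇔ to from
  where
  entry : Fin n → Bool
  entry i = lookup σ i ≡ᵇ lookup π i
  to : σ =ᵖ π ≡ true → σ ≡ π
  to h = begin
    σ                   ≡⟨ Vec.tabulate∘lookup σ ⟨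
    tabulate (lookup σ) ≡⟨ Vec.tabulate-cong (λ i →
                             Equivalence.to ≡ᵇ-true⇔≡ (Equivalence.to (allᵇ-allFin-true⇔ entry) h i)) ⟩
    tabulate (lookup π) ≡⟨ Vec.tabulate∘lookup π ⟩
    π                   ∎
    where open ≡-Reasoning
  from : σ ≡ π → σ =ᵖ π ≡ true
  from refl = Equivalence.from (allᵇ-allFin-true⇔ entry) λ i → Equivalence.from (≡ᵇ-true⇔≡ {lookup σ i}) refl

-- Restricted growth strings and canonical labelling

-- RGS m v: v is a restricted growth string in which the labels 0, …, m - 1 are already in use.
data RGS : ℕ → Vec ℕ k → Set where
  []  : RGS m []
  old : ∀ {a} {v : Vec ℕ k} → a ℕ.< m → RGS m v → RGS m (a ∷ v)
  new : ∀ {v : Vec ℕ k} → RGS (suc m) v → RGS m (m ∷ v)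

private
  next-old : ∀ {a} → a ℕ.< m → (if a ≡ᵇ m then suc m else m) ≡ m
  next-old a<m rewrite ≢⇒≡ᵇ-false (ℕ.<⇒≢ a<m) = refl

  next-new : (if m ≡ᵇ m then suc m else m) ≡ suc m
  next-new {m} rewrite Equivalence.from (≡ᵇ-true⇔≡ {m}) refl = refl

∈rgs⇒RGS : ∀ k m {v : Vec ℕ k} → v ∈ˡ rgs k m → RGS m v
∈rgs⇒RGS zero    m (here refl) = []
∈rgs⇒RGS (suc k) m v∈ with find (∈-concatMap⁻ _ {xs = upTo (suc m)} v∈)
... | a , a∈ , v∈ᵃ with ∈-map⁻ (a ∷_) v∈ᵃ | ℕ.m<1+n⇒m<n∨m≡n (∈-upTo⁻ a∈)
... | w , w∈ , refl | inj₁ a<m  = old a<m (∈rgs⇒RGS k m (subst (λ t → w ∈ˡ rgs k t) (next-old a<m) w∈))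
... | w , w∈ , refl | inj₂ refl = new (∈rgs⇒RGS k (suc m) (subst (λ t → w ∈ˡ rgs k t) next-new w∈))

RGS⇒∈rgs : ∀ {k m} {v : Vec ℕ k} → RGS m v → v ∈ˡ rgs k m
RGS⇒∈rgs []                              = here refl
RGS⇒∈rgs {suc k} {m} (old {a = a} a<m r) = ∈-concatMap⁺ _ (lose (∈-upTo⁺ (ℕ.m<n⇒m<1+n a<m))
  (∈-map⁺ (a ∷_) (subst (λ t → _ ∈ˡ rgs k t) (sym (next-old a<m)) (RGS⇒∈rgs r))))
RGS⇒∈rgs {suc k} {m} (new r)             = ∈-concatMap⁺ _ (lose (∈-upTo⁺ (ℕ.n<1+n m))
  (∈-map⁺ (m ∷_) (subst (λ t → _ ∈ˡ rgs k t) (sym next-new) (RGS⇒∈rgs r))))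

rgs-unique : ∀ k m → Unique (rgs k m)
rgs-unique zero    m = All.[] ∷ []
rgs-unique (suc k) m = Unique.concat⁺
  (All.map⁺ (All.tabulate (λ _ → Unique.map⁺ (λ { refl → refl }) (rgs-unique k _))))
  (AllPairs.map⁺ (AllPairs.map (λ a≢b {v} (v∈ᵃ , v∈ᵇ) → a≢b (head-≡ v∈ᵃ v∈ᵇ)) (Unique.upTo⁺ (suc m))))
  where
  head-≡ : ∀ {a b} {v : Vec ℕ (suc k)} {xs ys} → v ∈ˡ map (a ∷_) xs → v ∈ˡ map (b ∷_) ys → a ≡ b
  head-≡ {a} {b} v∈ᵃ v∈ᵇ with ∈-map⁻ (a ∷_) v∈ᵃ | ∈-map⁻ (b ∷_) v∈ᵇ
  ... | _ , _ , refl | _ , _ , refl = refl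

Π-unique : ∀ n → Unique (Π n)
Π-unique n = rgs-unique n 0

private
  AgreeBelow : ℕ → Vec ℕ k → Vec ℕ k → Set
  AgreeBelow m x y = ∀ i {ℓ} → ℓ ℕ.< m → lookup x i ≡ ℓ → lookup y i ≡ ℓ

  agree-new : ∀ {x y : Vec ℕ k} → Refines (lookup (m ∷ x)) (lookup (m ∷ y)) →
    AgreeBelow m (m ∷ x) (m ∷ y) → AgreeBelow (suc m) x y
  agree-new xy agree i ℓ<1+m xᵢ≡ℓ with ℕ.m<1+n⇒m<n∨m≡n ℓ<1+m
  ... | inj₁ ℓ<m  = agree (fsuc i) ℓ<m xᵢ≡ℓ
  ... | inj₂ refl = xy (fsuc i) fzero xᵢ≡ℓ

  RGS-kernel-injective : ∀ {x y : Vec ℕ k} → RGS m x → RGS m y →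
    Refines (lookup x) (lookup y) → Refines (lookup y) (lookup x) →
    AgreeBelow m x y → AgreeBelow m y x → x ≡ y
  RGS-kernel-injective [] [] _ _ _ _ = refl
  RGS-kernel-injective (old a<m rx) (old _ ry) xy yx axy ayx with refl ← axy fzero a<m refl =
    cong (_ ∷_) (RGS-kernel-injective rx ry (λ i j → xy (fsuc i) (fsuc j)) (λ i j → yx (fsuc i) (fsuc j))
      (λ i → axy (fsuc i)) (λ i → ayx (fsuc i)))
  RGS-kernel-injective (old a<m _) (new _) _ _ axy _ = ⊥-elim (ℕ.<-irrefl (sym (axy fzero a<m refl)) a<m)
  RGS-kernel-injective (new _) (old b<m _) _ _ _ ayx = ⊥-elim (ℕ.<-irrefl (sym (ayx fzero b<m refl)) b<m)
  RGS-kernel-injective (new rx) (new ry) xy yx axy ayx =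
    cong (_ ∷_) (RGS-kernel-injective rx ry (λ i j → xy (fsuc i) (fsuc j)) (λ i j → yx (fsuc i) (fsuc j))
      (agree-new xy axy) (agree-new yx ayx))

Π-kernel-injective : ∀ {x y : Vec ℕ n} → x ∈ˡ Π n → y ∈ˡ Π n →
  Refines (lookup x) (lookup y) → Refines (lookup y) (lookup x) → x ≡ y
Π-kernel-injective {n} x∈ y∈ xy yx =
  RGS-kernel-injective (∈rgs⇒RGS n 0 x∈) (∈rgs⇒RGS n 0 y∈) xy yx (λ _ ()) (λ _ ())

private
  extend : (ℕ → ℕ) → ℕ → ℕ → ℕ → ℕ
  extend c m a ℓ = if ℓ ≡ᵇ m then a else c ℓ

  extend-new : ∀ c m a → extend c m a m ≡ a
  extend-new c m a rewrite Equivalence.from (≡ᵇ-true⇔≡ {m}) refl = refl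

  extend-old : ∀ c {m} a {ℓ} → ℓ ℕ.< m → extend c m a ℓ ≡ c ℓ
  extend-old c a ℓ<m rewrite ≢⇒≡ᵇ-false (ℕ.<⇒≢ ℓ<m) = refl

  InjectiveBelow : ℕ → (ℕ → ℕ) → Set
  InjectiveBelow m c = ∀ {ℓ ℓ′} → ℓ ℕ.< m → ℓ′ ℕ.< m → c ℓ ≡ c ℓ′ → ℓ ≡ ℓ′

  Fresh : ℕ → (ℕ → ℕ) → ℕ → Set
  Fresh m c a = ∀ {ℓ} → ℓ ℕ.< m → c ℓ ≢ a

  fresh : ∀ {m} c a → ¬ (∃ λ (ℓ : Fin m) → c (toℕ ℓ) ≡ a) → Fresh m c a
  fresh c a ∄ℓ {ℓ} ℓ<m cℓ≡a = ∄ℓ (fromℕ< ℓ<m , subst (λ t → c t ≡ a) (sym (Fin.toℕ-fromℕ< ℓ<m)) cℓ≡a)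

  extend-injective : ∀ {c a} → InjectiveBelow m c → Fresh m c a → InjectiveBelow (suc m) (extend c m a)
  extend-injective {m} {c} {a} inj a-fresh {ℓ} {ℓ′} ℓ< ℓ′< eq
    with ℕ.m<1+n⇒m<n∨m≡n ℓ< | ℕ.m<1+n⇒m<n∨m≡n ℓ′<
  ... | inj₁ ℓ<m  | inj₁ ℓ′<m = inj ℓ<m ℓ′<m (trans (sym (extend-old c a ℓ<m)) (trans eq (extend-old c a ℓ′<m)))
  ... | inj₁ ℓ<m  | inj₂ refl = ⊥-elim (a-fresh ℓ<m (trans (sym (extend-old c a ℓ<m)) (trans eq (extend-new c m a))))
  ... | inj₂ refl | inj₁ ℓ′<m = ⊥-elim (a-fresh ℓ′<m (trans (sym (extend-old c a ℓ′<m)) (trans (sym eq) (extend-new c m a))))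
  ... | inj₂ refl | inj₂ refl = refl

-- relabel k m c w: the labels ℓ < m already stand for the values c ℓ; every other value of w
-- receives the next fresh label m, m + 1, … at its first occurrence.
relabel : ∀ k → ℕ → (ℕ → ℕ) → (Fin k → ℕ) → Vec ℕ k
relabel zero    m c w = []
relabel (suc k) m c w with Fin.any? (λ (ℓ : Fin m) → c (toℕ ℓ) ℕ.≟ w fzero)
... | yes (ℓ , _) = toℕ ℓ ∷ relabel k m c (w ∘ fsuc)
... | no _        = m ∷ relabel k (suc m) (extend c m (w fzero)) (w ∘ fsuc)

relabel-RGS : ∀ k m c w → RGS m (relabel k m c w)
relabel-RGS zero    m c w = []
relabel-RGS (suc k) m c w with Fin.any? (λ (ℓ : Fin m) → c (toℕ ℓ) ℕ.≟ w fzero)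
... | yes (ℓ , _) = old (Fin.toℕ<n ℓ) (relabel-RGS k m c (w ∘ fsuc))
... | no _        = new (relabel-RGS k (suc m) _ (w ∘ fsuc))

relabel-old : ∀ k m c w → InjectiveBelow m c → ∀ i {ℓ} → ℓ ℕ.< m →
  (lookup (relabel k m c w) i ≡ ℓ) ⇔ (w i ≡ c ℓ)
relabel-old (suc k) m c w inj i ℓ<m with Fin.any? (λ (ℓ : Fin m) → c (toℕ ℓ) ℕ.≟ w fzero)
relabel-old (suc k) m c w inj fzero    ℓ<m | yes (ℓ₀ , cℓ₀≡w₀) =
  mk⇔ (λ { refl → sym cℓ₀≡w₀ }) (λ w₀≡cℓ → inj (Fin.toℕ<n ℓ₀) ℓ<m (trans cℓ₀≡w₀ w₀≡cℓ))
relabel-old (suc k) m c w inj (fsuc i) ℓ<m | yes _ = relabel-old k m c (w ∘ fsuc) inj i ℓ<m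
relabel-old (suc k) m c w inj fzero    ℓ<m | no ∄ℓ =
  mk⇔ (λ { refl → ⊥-elim (ℕ.<-irrefl refl ℓ<m) }) (λ w₀≡cℓ → ⊥-elim (fresh c _ ∄ℓ ℓ<m (sym w₀≡cℓ)))
relabel-old (suc k) m c w inj (fsuc i) ℓ<m | no ∄ℓ =
  ⇔-trans (relabel-old k (suc m) _ (w ∘ fsuc) (extend-injective inj (fresh c _ ∄ℓ)) i (ℕ.m<n⇒m<1+n ℓ<m))
          (≡-rhs⇔ (extend-old c (w fzero) ℓ<m))

private
  relabel-head : ∀ k m c w → InjectiveBelow m c → ∀ j →
    (lookup (relabel (suc k) m c w) (fsuc j) ≡ lookup (relabel (suc k) m c w) fzero) ⇔ (w (fsuc j) ≡ w fzero)
  relabel-head k m c w inj j with Fin.any? (λ (ℓ : Fin m) → c (toℕ ℓ) ℕ.≟ w fzero)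
  ... | yes (ℓ₀ , cℓ₀≡w₀) =
    ⇔-trans (relabel-old k m c (w ∘ fsuc) inj j (Fin.toℕ<n ℓ₀)) (≡-rhs⇔ cℓ₀≡w₀)
  ... | no ∄ℓ =
    ⇔-trans (relabel-old k (suc m) _ (w ∘ fsuc) (extend-injective inj (fresh c _ ∄ℓ)) j (ℕ.n<1+n m))
            (≡-rhs⇔ (extend-new c m (w fzero)))

relabel-kernel : ∀ k m c w → InjectiveBelow m c → SameKernel (lookup (relabel k m c w)) w
relabel-kernel (suc k) m c w inj fzero    fzero    = mk⇔ (λ _ → refl) (λ _ → refl)
relabel-kernel (suc k) m c w inj fzero    (fsuc j) = ⇔-trans ≡-sym⇔ (⇔-trans (relabel-head k m c w inj j) ≡-sym⇔)
relabel-kernel (suc k) m c w inj (fsuc i) fzero    = relabel-head k m c w inj i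
relabel-kernel (suc k) m c w inj (fsuc i) (fsuc j) with Fin.any? (λ (ℓ : Fin m) → c (toℕ ℓ) ℕ.≟ w fzero)
... | yes _  = relabel-kernel k m c (w ∘ fsuc) inj i j
... | no ∄ℓ = relabel-kernel k (suc m) _ (w ∘ fsuc) (extend-injective inj (fresh c _ ∄ℓ)) i j

canon : (Fin k → ℕ) → Vec ℕ k
canon w = relabel _ 0 (λ _ → 0) w

canon-∈Π : (w : Fin k → ℕ) → canon w ∈ˡ Π k
canon-∈Π {k} w = RGS⇒∈rgs (relabel-RGS k 0 _ w)

canon-kernel : (w : Fin k → ℕ) → SameKernel (lookup (canon w)) w
canon-kernel {k} w = relabel-kernel k 0 _ w (λ ())

-- Number of blocks

OpensBlock : (Fin k → ℕ) → Fin k → Set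
OpensBlock v i = ∀ j → j < i → v j ≢ v i

opensBlock? : (v : Fin k → ℕ) → ∀ i → Dec (OpensBlock v i)
opensBlock? v i = Fin.all? (λ j → (j Fin.<? i) →-dec ¬? (v j ℕ.≟ v i))

openers : (Fin k → ℕ) → Subset k
openers v = tabulate (λ i → does (opensBlock? v i))

blocks : (Fin k → ℕ) → ℕ
blocks v = ∣ openers v ∣

∈-openers⇔ : (v : Fin k → ℕ) → ∀ i → i ∈ openers v ⇔ OpensBlock v i
∈-openers⇔ v i = mk⇔
  (λ i∈ → does-true⇒ (opensBlock? v i) (trans (sym (Vec.lookup∘tabulate _ i)) (Vec.[]=⇒lookup i∈)))
  (λ opens → Vec.lookup⇒[]= i _ (trans (Vec.lookup∘tabulate _ i) (dec-true (opensBlock? v i) opens)))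

opener-of : (v : Fin k → ℕ) → ∀ i → ∃ λ a → OpensBlock v a × v a ≡ v i
opener-of {k} v i with Fin.¬∀⟶∃¬-smallest k (λ j → v j ≢ v i) (λ j → ¬? (v j ℕ.≟ v i)) (λ h → h i refl)
... | a , ¬va≢vi , earlier = a , opens , va≡vi
  where
  va≡vi : v a ≡ v i
  va≡vi = decidable-stable (v a ℕ.≟ v i) ¬va≢vi
  inject-fromℕ< : ∀ {j} (j<a : toℕ j ℕ.< toℕ a) → inject (fromℕ< j<a) ≡ j
  inject-fromℕ< j<a = Fin.toℕ-injective (trans (Fin.toℕ-inject (fromℕ< j<a)) (Fin.toℕ-fromℕ< j<a))
  opens : OpensBlock v a
  opens j j<a vⱼ≡vₐ =
    earlier (fromℕ< j<a) (subst (λ t → v t ≡ v i) (sym (inject-fromℕ< j<a)) (trans vⱼ≡vₐ va≡vi))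

openers-antitone : {τ π : Fin k → ℕ} → Refines τ π → openers π ⊆ openers τ
openers-antitone {τ = τ} {π} τ⊑π {i} i∈ = Equivalence.from (∈-openers⇔ τ i)
  (λ j j<i τⱼ≡τᵢ → Equivalence.to (∈-openers⇔ π i) i∈ j j<i (τ⊑π j i τⱼ≡τᵢ))

blocks-antitone : {τ π : Fin k → ℕ} → Refines τ π → blocks π ℕ.≤ blocks τ
blocks-antitone = p⊆q⇒∣p∣≤∣q∣ ∘ openers-antitone

blocks-≤ : (v : Fin k → ℕ) → blocks v ℕ.≤ k
blocks-≤ v = ∣p∣≤n (openers v)

private
  ¬Refines⇒witness : (v w : Fin k → ℕ) → ¬ Refines v w → ∃₂ λ i j → v i ≡ v j × w i ≢ w j
  ¬Refines⇒witness {k} v w ¬v⊑w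
    with Fin.¬∀⟶∃¬ k _ (λ i → Fin.all? (λ j → (v i ℕ.≟ v j) →-dec (w i ℕ.≟ w j))) ¬v⊑w
  ... | i , ¬row with Fin.¬∀⟶∃¬ k _ (λ j → (v i ℕ.≟ v j) →-dec (w i ℕ.≟ w j)) ¬row
  ... | j , ¬entry with v i ℕ.≟ v j | w i ℕ.≟ w j
  ... | yes vᵢ≡vⱼ | no wᵢ≢wⱼ  = i , j , vᵢ≡vⱼ , wᵢ≢wⱼ
  ... | yes _     | yes wᵢ≡wⱼ = ⊥-elim (¬entry (λ _ → wᵢ≡wⱼ))
  ... | no vᵢ≢vⱼ  | _         = ⊥-elim (¬entry (⊥-elim ∘ vᵢ≢vⱼ))

  -- The τ-block of x starts after b, which opens the π-block of x, so its opener opens no π-block.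
  new-opener : {τ π : Fin k → ℕ} → Refines τ π → ∀ {b x} → OpensBlock π b → π b ≡ π x → τ b ≢ τ x →
    ∃ λ a → OpensBlock τ a × ¬ OpensBlock π a
  new-opener {τ = τ} {π} τ⊑π {b} {x} b-opens π-b≡x τ-b≢x with opener-of τ x
  ... | a , a-opens , τ-a≡x with Fin.<-cmp a b
  ... | tri< a<b _ _  = ⊥-elim (b-opens a a<b (trans (τ⊑π a x τ-a≡x) (sym π-b≡x)))
  ... | tri≈ _ refl _ = ⊥-elim (τ-b≢x τ-a≡x)
  ... | tri> _ _ b<a  = a , a-opens , λ a-opens-π → a-opens-π b b<a (trans π-b≡x (sym (τ⊑π a x τ-a≡x)))

  blocks-<-by-opener : {τ π : Fin k → ℕ} → Refines τ π →
    (∃ λ a → OpensBlock τ a × ¬ OpensBlock π a) → blocks π ℕ.< blocks τ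
  blocks-<-by-opener {τ = τ} {π} τ⊑π (a , a-opens , ¬a-opens) = p⊂q⇒∣p∣<∣q∣
    (openers-antitone τ⊑π , a , Equivalence.from (∈-openers⇔ τ a) a-opens , ¬a-opens ∘ Equivalence.to (∈-openers⇔ π a))

blocks-strict : {τ π : Vec ℕ k} → τ ∈ˡ Π k → π ∈ˡ Π k → Refines (lookup τ) (lookup π) → τ ≢ π →
  blocks (lookup π) ℕ.< blocks (lookup τ)
blocks-strict {τ = τ} {π} τ∈ π∈ τ⊑π τ≢π
  with ¬Refines⇒witness (lookup π) (lookup τ) (τ≢π ∘ Π-kernel-injective τ∈ π∈ τ⊑π)
... | i , j , πᵢ≡πⱼ , τᵢ≢τⱼ with opener-of (lookup π) i
... | b , b-opens , π-b≡i with lookup τ b ℕ.≟ lookup τ i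
... | yes τ-b≡i = blocks-<-by-opener τ⊑π
  (new-opener τ⊑π b-opens (trans π-b≡i πᵢ≡πⱼ) (λ τ-b≡j → τᵢ≢τⱼ (trans (sym τ-b≡i) τ-b≡j)))
... | no τ-b≢i  = blocks-<-by-opener τ⊑π (new-opener τ⊑π b-opens π-b≡i τ-b≢i)

-- Sums and the Möbius function

map-unique : ∀ {A B : Set} {F : A → B} xs → Unique xs →
  (∀ {x y} → x ∈ˡ xs → y ∈ˡ xs → F x ≡ F y → x ≡ y) → Unique (map F xs)
map-unique []       []          _     = []
map-unique (x ∷ xs) (x∉ ∷ xs!) F-inj =
  All.map⁺ (All.tabulate (λ y∈ Fx≡Fy → All.lookup x∉ y∈ (F-inj (here refl) (there y∈) Fx≡Fy)))
  ∷ map-unique xs xs! (λ x∈ y∈ → F-inj (there x∈) (there y∈))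

private
  ∈-open-interval⁻ : ∀ {σ π τ : Vec ℕ k} →
    τ ∈ˡ filter (λ τ → ((σ ≤ᵖ τ) ∧ (τ ≤ᵖ π) ∧ not (τ =ᵖ π)) Bool.≟ true) (Π k) →
    τ ∈ˡ Π k × Refines (lookup σ) (lookup τ) × Refines (lookup τ) (lookup π) × τ ≢ π
  ∈-open-interval⁻ {σ = σ} {π} {τ} τ∈ with ∈-filter⁻ _ τ∈
  ... | τ∈Π , inside with Equivalence.to ∧-true⇔ inside
  ... | σ≤τ , rest with Equivalence.to (∧-true⇔ {τ ≤ᵖ π}) rest
  ... | τ≤π , τ≠π =
    τ∈Π , Equivalence.to (≤ᵖ-true⇔Refines σ τ) σ≤τ , Equivalence.to (≤ᵖ-true⇔Refines τ π) τ≤π ,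
    λ τ≡π → false≢true (trans (sym (Equivalence.to not-true⇔ τ≠π)) (Equivalence.from (=ᵖ-true⇔≡ τ π) τ≡π))
    where
    false≢true : false ≢ true
    false≢true ()

  blocks-budget : ∀ {a g b c} → a ℕ.< suc g ℕ.+ b → b ℕ.< c → a ℕ.< g ℕ.+ c
  blocks-budget {g = g} a<1+g+b b<c =
    ℕ.<-≤-trans a<1+g+b (ℕ.≤-trans (ℕ.≤-reflexive (sym (ℕ.+-suc g _))) (ℕ.+-monoʳ-≤ g b<c))

module _ {c ℓ : Level} (R : CommutativeRing c ℓ) where
  open CommutativeRing R renaming (refl to ≈-refl)

  Σᴿ-cong : ∀ {A : Set} {g h : A → Carrier} xs → (∀ {x} → x ∈ˡ xs → g x ≈ h x) →
    Σᴿ R (map g xs) ≈ Σᴿ R (map h xs)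
  Σᴿ-cong []       _   = ≈-refl
  Σᴿ-cong (x ∷ xs) g≈h = +-cong (g≈h (here refl)) (Σᴿ-cong xs (g≈h ∘ there))

  Σᴿ-↭ : ∀ {xs ys} → xs ↭ ys → Σᴿ R xs ≈ Σᴿ R ys
  Σᴿ-↭ = foldr-commMonoid setoid +-isCommutativeMonoid ∘ ↭⇒↭ₛ′ isEquivalence

  Σᴿ-reindex : ∀ {A B : Set} {xs : List A} {ys : List B} (F : A → B) {g : A → Carrier} {h : B → Carrier} →
    Unique xs → Unique ys →
    (∀ {x y} → x ∈ˡ xs → y ∈ˡ xs → F x ≡ F y → x ≡ y) →
    (∀ {x} → x ∈ˡ xs → F x ∈ˡ ys) →
    (∀ {y} → y ∈ˡ ys → ∃ λ x → x ∈ˡ xs × F x ≡ y) →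
    (∀ {x} → x ∈ˡ xs → g x ≈ h (F x)) →
    Σᴿ R (map g xs) ≈ Σᴿ R (map h ys)
  Σᴿ-reindex {xs = xs} {ys} F {g} {h} xs! ys! F-inj F-into F-onto g≈hF = begin
    Σᴿ R (map g xs)         ≈⟨ Σᴿ-cong xs g≈hF ⟩
    Σᴿ R (map (h ∘ F) xs)   ≡⟨ cong (Σᴿ R) (List.map-∘ xs) ⟩
    Σᴿ R (map h (map F xs)) ≈⟨ Σᴿ-↭ (↭.map⁺ h (∼bag⇒↭ (unique∧set⇒bag (map-unique xs xs! F-inj) ys! (mk⇔ into onto)))) ⟩
    Σᴿ R (map h ys)         ∎
    where
    open import Relation.Binary.Reasoning.Setoid setoid
    into : ∀ {z} → z ∈ˡ map F xs → z ∈ˡ ys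
    into z∈ with ∈-map⁻ F z∈
    ... | x , x∈ , refl = F-into x∈
    onto : ∀ {z} → z ∈ˡ ys → z ∈ˡ map F xs
    onto z∈ with F-onto z∈
    ... | x , x∈ , refl = ∈-map⁺ F x∈

  -- Each recursive call of μ-fuel moves to a partition with strictly more blocks.
  μ-fuel-stable : ∀ f f′ {σ π : Vec ℕ k} → σ ∈ˡ Π k → π ∈ˡ Π k → Refines (lookup σ) (lookup π) →
    blocks (lookup σ) ℕ.< f ℕ.+ blocks (lookup π) → blocks (lookup σ) ℕ.< f′ ℕ.+ blocks (lookup π) →
    μ-fuel R f σ π ≈ μ-fuel R f′ σ π
  μ-fuel-stable zero    _        _ _ σ⊑π b< _  = ⊥-elim (ℕ.<⇒≱ b< (blocks-antitone σ⊑π))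
  μ-fuel-stable (suc g) zero     _ _ σ⊑π _  b< = ⊥-elim (ℕ.<⇒≱ b< (blocks-antitone σ⊑π))
  μ-fuel-stable (suc g) (suc g′) {σ} {π} σ∈ π∈ σ⊑π b<f b<f′ with σ =ᵖ π | σ ≤ᵖ π
  ... | true  | _     = ≈-refl
  ... | false | false = ≈-refl
  ... | false | true  = -‿cong (Σᴿ-cong _ λ τ∈ → step (∈-open-interval⁻ {σ = σ} {π} τ∈))
    where
    step : ∀ {τ} → τ ∈ˡ Π _ × Refines (lookup σ) (lookup τ) × Refines (lookup τ) (lookup π) × τ ≢ π →
      μ-fuel R g σ τ ≈ μ-fuel R g′ σ τ
    step (τ∈ , σ⊑τ , τ⊑π , τ≢π) = μ-fuel-stable g g′ σ∈ τ∈ σ⊑τ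
      (blocks-budget b<f (blocks-strict τ∈ π∈ τ⊑π τ≢π)) (blocks-budget b<f′ (blocks-strict τ∈ π∈ τ⊑π τ≢π))

  μ-fuel≈μ : ∀ f → k ℕ.< f → {σ π : Vec ℕ k} → σ ∈ˡ Π k → π ∈ˡ Π k → Refines (lookup σ) (lookup π) →
    μ-fuel R f σ π ≈ μ R σ π
  μ-fuel≈μ {k} f k<f {σ} {π} σ∈ π∈ σ⊑π = μ-fuel-stable f (suc k) σ∈ π∈ σ⊑π (enough k<f) (enough ℕ.≤-refl)
    where
    enough : ∀ {f} → k ℕ.< f → blocks (lookup σ) ℕ.< f ℕ.+ blocks (lookup π)
    enough {f} k<f = ℕ.≤-<-trans (blocks-≤ (lookup σ)) (ℕ.<-≤-trans k<f (ℕ.m≤m+n f _))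

-- Products and exchangeability

StrictlyIncreasing : (Fin m → Fin k) → Set
StrictlyIncreasing e = ∀ i j → i < j → e i < e j

private
  later≢0 : (e : Fin (suc m) → Fin (suc k)) → StrictlyIncreasing e → ∀ i → e (fsuc i) ≢ fzero
  later≢0 e e-inc i eᵢ₊₁≡0 =
    ℕ.n≮0 (subst (λ t → toℕ (e fzero) ℕ.< toℕ t) eᵢ₊₁≡0 (e-inc fzero (fsuc i) ℕ.z<s))

  shift-down : (e : Fin m → Fin (suc k)) → (∀ i → e i ≢ fzero) → Fin m → Fin k
  shift-down e e≢0 i = punchOut (e≢0 i ∘ sym)

  fsuc-shift-down : ∀ (e : Fin m → Fin (suc k)) e≢0 i → fsuc (shift-down e e≢0 i) ≡ e i
  fsuc-shift-down e e≢0 i = Fin.punchIn-punchOut (e≢0 i ∘ sym)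

  shift-down-increasing : ∀ (e : Fin m → Fin (suc k)) e≢0 → StrictlyIncreasing e →
    StrictlyIncreasing (shift-down e e≢0)
  shift-down-increasing e e≢0 e-inc i j i<j = ℕ.s<s⁻¹
    (subst₂ ℕ._<_ (cong toℕ (sym (fsuc-shift-down e e≢0 i))) (cong toℕ (sym (fsuc-shift-down e e≢0 j)))
            (e-inc i j i<j))

module _ {r ℓr u ℓu : Level} {R : CommutativeRing r ℓr} (U : UnitalAlgebra R u ℓu) where
  open UnitalAlgebra U using (Carrier; _≈_; _*_; 1#; *-cong; *-identityˡ; setoid; reflexive)
    renaming (refl to ≈-refl)
  open import Relation.Binary.Reasoning.Setoid setoid

  prod-cong : ∀ k {f g : Fin k → Carrier} → (∀ i → f i ≈ g i) → prod U k f ≈ prod U k g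
  prod-cong zero    f≈g = ≈-refl
  prod-cong (suc k) f≈g = *-cong (f≈g fzero) (prod-cong k (f≈g ∘ fsuc))

  prod-drop-units : ∀ k m (f : Fin k → Carrier) (e : Fin m → Fin k) → StrictlyIncreasing e →
    (∀ j → (∀ i → e i ≢ j) → f j ≈ 1#) → prod U k f ≈ prod U m (f ∘ e)
  prod-drop-units zero    zero    f e _ _ = ≈-refl
  prod-drop-units zero    (suc m) f e _ _ with () ← e fzero
  prod-drop-units (suc k) zero    f e _ units = begin
    f fzero * prod U k (f ∘ fsuc) ≈⟨ *-cong (units fzero λ ())
                                       (prod-drop-units k zero (f ∘ fsuc) (λ ()) (λ ()) (λ j _ → units (fsuc j) (λ ()))) ⟩
    1# * 1#                       ≈⟨ *-identityˡ 1# ⟩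
    1#                            ∎
  prod-drop-units (suc k) (suc m) f e e-inc units with e fzero Fin.≟ fzero
  ... | yes e₀≡0 = *-cong (reflexive (cong f (sym e₀≡0))) (begin
    prod U k (f ∘ fsuc)      ≈⟨ prod-drop-units k m (f ∘ fsuc) e′ (shift-down-increasing _ e≢0 e-inc′) units′ ⟩
    prod U m (f ∘ fsuc ∘ e′) ≈⟨ prod-cong m (λ i → reflexive (cong f (fsuc-shift-down _ e≢0 i))) ⟩
    prod U m (f ∘ e ∘ fsuc)  ∎)
    where
    e-inc′ : StrictlyIncreasing (e ∘ fsuc)
    e-inc′ i j i<j = e-inc (fsuc i) (fsuc j) (ℕ.s<s i<j)
    e≢0 : ∀ i → e (fsuc i) ≢ fzero
    e≢0 = later≢0 e e-inc
    e′ : Fin m → Fin k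
    e′ = shift-down (e ∘ fsuc) e≢0
    units′ : ∀ j → (∀ i → e′ i ≢ j) → f (fsuc j) ≈ 1#
    units′ j j∉e′ = units (fsuc j) λ
      { fzero    e₀≡j   → Fin.0≢1+n (trans (sym e₀≡0) e₀≡j)
      ; (fsuc i) eᵢ₊₁≡j → j∉e′ i (Fin.suc-injective (trans (fsuc-shift-down _ e≢0 i) eᵢ₊₁≡j)) }
  ... | no e₀≢0 = begin
    f fzero * prod U k (f ∘ fsuc)  ≈⟨ *-cong (units fzero e≢0) ≈-refl ⟩
    1# * prod U k (f ∘ fsuc)       ≈⟨ *-identityˡ _ ⟩
    prod U k (f ∘ fsuc)            ≈⟨ prod-drop-units k (suc m) (f ∘ fsuc) e′ (shift-down-increasing e e≢0 e-inc) units′ ⟩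
    prod U (suc m) (f ∘ fsuc ∘ e′) ≈⟨ prod-cong (suc m) (λ i → reflexive (cong f (fsuc-shift-down e e≢0 i))) ⟩
    prod U (suc m) (f ∘ e)         ∎
    where
    e≢0 : ∀ i → e i ≢ fzero
    e≢0 fzero    = e₀≢0
    e≢0 (fsuc i) = later≢0 e e-inc i
    e′ : Fin (suc m) → Fin k
    e′ = shift-down e e≢0
    units′ : ∀ j → (∀ i → e′ i ≢ j) → f (fsuc j) ≈ 1#
    units′ j j∉e′ = units (fsuc j) λ i eᵢ≡j → j∉e′ i (Fin.suc-injective (trans (fsuc-shift-down e e≢0 i) eᵢ≡j))

bounded : (w : Fin k → ℕ) → ∃ λ B → ∀ i → w i ℕ.< B
bounded {zero}  w = 0 , λ ()
bounded {suc k} w with bounded (w ∘ fsuc)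
... | B , w<B = suc (w fzero) ℕ.+ B , λ
  { fzero    → ℕ.m≤m+n (suc (w fzero)) B
  ; (fsuc i) → ℕ.<-≤-trans (w<B i) (ℕ.m≤n+m B (suc (w fzero))) }

module _ {k} (w v : Fin k → ℕ) (w≈v : SameKernel w v) (w#v : ∀ i j → w i ≢ v j) where
  private
    swap : ℕ → ℕ
    swap x with Fin.any? (λ i → w i ℕ.≟ x)
    ... | yes (i , _) = v i
    ... | no _ with Fin.any? (λ i → v i ℕ.≟ x)
    ...   | yes (i , _) = w i
    ...   | no _        = x

    swap-w : ∀ j → swap (w j) ≡ v j
    swap-w j with Fin.any? (λ i → w i ℕ.≟ w j)
    ... | yes (i , wᵢ≡wⱼ) = Equivalence.to (w≈v i j) wᵢ≡wⱼ
    ... | no ∄i           = ⊥-elim (∄i (j , refl))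

    swap-v : ∀ j → swap (v j) ≡ w j
    swap-v j with Fin.any? (λ i → w i ℕ.≟ v j)
    ... | yes (i , wᵢ≡vⱼ) = ⊥-elim (w#v i j wᵢ≡vⱼ)
    ... | no _ with Fin.any? (λ i → v i ℕ.≟ v j)
    ...   | yes (i , vᵢ≡vⱼ) = Equivalence.from (w≈v i j) vᵢ≡vⱼ
    ...   | no ∄i           = ⊥-elim (∄i (j , refl))

    swap-fixed : ∀ {x} → ¬ (∃ λ i → w i ≡ x) → ¬ (∃ λ i → v i ≡ x) → swap x ≡ x
    swap-fixed {x} ∄w ∄v with Fin.any? (λ i → w i ℕ.≟ x)
    ... | yes ∃w = ⊥-elim (∄w ∃w)
    ... | no _ with Fin.any? (λ i → v i ℕ.≟ x)
    ...   | yes ∃v = ⊥-elim (∄v ∃v)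
    ...   | no _   = refl

    swap-involutive : ∀ x → swap (swap x) ≡ x
    swap-involutive x = by-cases (Fin.any? (λ i → w i ℕ.≟ x)) (Fin.any? (λ i → v i ℕ.≟ x))
      where
      by-cases : Dec (∃ λ i → w i ≡ x) → Dec (∃ λ i → v i ≡ x) → swap (swap x) ≡ x
      by-cases (yes (i , wᵢ≡x)) _ =
        subst (λ t → swap (swap t) ≡ t) wᵢ≡x (trans (cong swap (swap-w i)) (swap-v i))
      by-cases (no _) (yes (i , vᵢ≡x)) =
        subst (λ t → swap (swap t) ≡ t) vᵢ≡x (trans (cong swap (swap-v i)) (swap-w i))
      by-cases (no ∄w) (no ∄v) = trans (cong swap (swap-fixed ∄w ∄v)) (swap-fixed ∄w ∄v)

  disjoint-relabelling : ∃ λ (ρ : ℕ ↔ ℕ) → ∀ j → Inverse.to ρ (w j) ≡ v j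
  disjoint-relabelling = mk↔ₛ′ swap swap swap-involutive swap-involutive , swap-w

-- Relabel w first to a copy of v shifted past all values of w and v, then to v itself.
relabelling : (w v : Fin k → ℕ) → SameKernel w v → ∃ λ (ρ : ℕ ↔ ℕ) → ∀ j → Inverse.to ρ (w j) ≡ v j
relabelling {k} w v w≈v =
  ↔-trans (proj₁ to-shifted) (proj₁ to-v) ,
  λ j → trans (cong (Inverse.to (proj₁ to-v)) (proj₂ to-shifted j)) (proj₂ to-v j)
  where
  B : ℕ
  B = proj₁ (bounded (λ i → w i ℕ.+ v i))
  shifted : Fin k → ℕ
  shifted i = B ℕ.+ v i
  shifted≈v : SameKernel shifted v
  shifted≈v i j = mk⇔ (ℕ.+-cancelˡ-≡ B _ _) (cong (B ℕ.+_))
  below-shifted : ∀ {a} i j → a ℕ.≤ w i ℕ.+ v i → a ≢ shifted j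
  below-shifted i j a≤ a≡ = ℕ.<⇒≱ (ℕ.≤-<-trans a≤ (proj₂ (bounded (λ i → w i ℕ.+ v i)) i))
                                  (subst (B ℕ.≤_) (sym a≡) (ℕ.m≤m+n B _))
  to-shifted : ∃ λ (ρ : ℕ ↔ ℕ) → ∀ j → Inverse.to ρ (w j) ≡ shifted j
  to-shifted = disjoint-relabelling w shifted (λ i j → ⇔-trans (w≈v i j) (⇔-sym (shifted≈v i j)))
    (λ i j → below-shifted i j (ℕ.m≤m+n (w i) (v i)))
  to-v : ∃ λ (ρ : ℕ ↔ ℕ) → ∀ j → Inverse.to ρ (shifted j) ≡ v j
  to-v = disjoint-relabelling shifted v shifted≈v (λ i j → below-shifted j i (ℕ.m≤n+m (v j) (w j)) ∘ sym)

module _ {r ℓr a ℓa u ℓu : Level} {R : CommutativeRing r ℓr} {P : NCProbabilitySpace {R = R} a ℓa}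
         (E : ExchangeabilitySystem P u ℓu) where
  open ExchangeabilitySystem E
  open CommutativeRing R using (_≈_) renaming (trans to ≈-trans)
  private module A = UnitalAlgebra (NCProbabilitySpace.algebra P)

  φ̃-relabel : ∀ {k} {w v : Fin k → ℕ} → SameKernel w v → (Y : Fin k → A.Carrier) →
    φ̃ (prod 𝒰 k (λ j → ι (w j) (Y j))) ≈ φ̃ (prod 𝒰 k (λ j → ι (v j) (Y j)))
  φ̃-relabel {k} {w} {v} w≈v Y with relabelling w v w≈v
  ... | ρ , ρ-w = ≈-trans (exchangeable k Y w ρ)
    (IsUnitalLinearFunctional.cong φ̃-isUnitalLinearFunctional
      (prod-cong 𝒰 k (λ j → UnitalAlgebra.reflexive 𝒰 (cong (λ t → ι t (Y j)) (ρ-w j)))))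

-- Removing the singletons on I

module Restriction {n m : ℕ} (e : Fin m → Fin n) (I : Subset n) (e-increasing : StrictlyIncreasing e)
  (e∉I : ∀ i → e i ∉ I) (e-onto : ∀ j → j ∉ I → ∃ λ i → e i ≡ j) where

  e-injective : ∀ {i k} → e i ≡ e k → i ≡ k
  e-injective {i} {k} eᵢ≡eₖ with Fin.<-cmp i k
  ... | tri< i<k _ _ = ⊥-elim (ℕ.<-irrefl (cong toℕ eᵢ≡eₖ) (e-increasing i k i<k))
  ... | tri≈ _ i≡k _ = i≡k
  ... | tri> _ _ k<i = ⊥-elim (ℕ.<-irrefl (cong toℕ (sym eᵢ≡eₖ)) (e-increasing k i k<i))

  m≤n : m ℕ.≤ n
  m≤n = Fin.injective⇒≤ e-injective

  SingletonsOnI : Vec ℕ n → Set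
  SingletonsOnI x = ∀ j → j ∈ I → ∀ k → lookup x k ≡ lookup x j → k ≡ j

  singletons-antitone : ∀ {x y} → Refines (lookup x) (lookup y) → SingletonsOnI y → SingletonsOnI x
  singletons-antitone x⊑y y-singletons j j∈I k xₖ≡xⱼ = y-singletons j j∈I k (x⊑y k j xₖ≡xⱼ)

  record Restricts (x : Vec ℕ n) (x̃ : Vec ℕ m) : Set where
    field
      x∈Π        : x ∈ˡ Π n
      x̃∈Π        : x̃ ∈ˡ Π m
      singletons : SingletonsOnI x
      kernel     : SameKernel (lookup x̃) (lookup x ∘ e)
  open Restricts

  refines-restrict : ∀ {x x̃ y ỹ} → Restricts x x̃ → Restricts y ỹ →
    Refines (lookup x) (lookup y) → Refines (lookup x̃) (lookup ỹ)
  refines-restrict x↦ y↦ x⊑y i k x̃ᵢ≡x̃ₖ =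
    Equivalence.from (kernel y↦ i k) (x⊑y (e i) (e k) (Equivalence.to (kernel x↦ i k) x̃ᵢ≡x̃ₖ))

  refines-extend : ∀ {x x̃ y ỹ} → Restricts x x̃ → Restricts y ỹ →
    Refines (lookup x̃) (lookup ỹ) → Refines (lookup x) (lookup y)
  refines-extend x↦ y↦ x̃⊑ỹ a b xₐ≡x_b with a ∈? I | b ∈? I
  ... | yes a∈I | _ with refl ← singletons x↦ a a∈I b (sym xₐ≡x_b) = refl
  ... | no _ | yes b∈I with refl ← singletons x↦ b b∈I a xₐ≡x_b = refl
  ... | no a∉I | no b∉I with e-onto a a∉I | e-onto b b∉I
  ... | i , refl | k , refl =
    Equivalence.to (kernel y↦ i k) (x̃⊑ỹ i k (Equivalence.from (kernel x↦ i k) xₐ≡x_b))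

  ≤ᵖ-restrict : ∀ {x x̃ y ỹ} → Restricts x x̃ → Restricts y ỹ → x ≤ᵖ y ≡ x̃ ≤ᵖ ỹ
  ≤ᵖ-restrict {x} {x̃} {y} {ỹ} x↦ y↦ = ⇔→≡ (mk⇔
    (λ x≤y → Equivalence.from (≤ᵖ-true⇔Refines x̃ ỹ)
      (refines-restrict x↦ y↦ (Equivalence.to (≤ᵖ-true⇔Refines x y) x≤y)))
    (λ x̃≤ỹ → Equivalence.from (≤ᵖ-true⇔Refines x y)
      (refines-extend x↦ y↦ (Equivalence.to (≤ᵖ-true⇔Refines x̃ ỹ) x̃≤ỹ))))

  ≡-restrict : ∀ {x x̃ y ỹ} → Restricts x x̃ → Restricts y ỹ → (x ≡ y) ⇔ (x̃ ≡ ỹ)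
  ≡-restrict x↦ y↦ = mk⇔
    (λ { refl → Π-kernel-injective (x̃∈Π x↦) (x̃∈Π y↦)
                  (refines-restrict x↦ y↦ (λ _ _ → id)) (refines-restrict y↦ x↦ (λ _ _ → id)) })
    (λ { refl → Π-kernel-injective (x∈Π x↦) (x∈Π y↦)
                  (refines-extend x↦ y↦ (λ _ _ → id)) (refines-extend y↦ x↦ (λ _ _ → id)) })

  =ᵖ-restrict : ∀ {x x̃ y ỹ} → Restricts x x̃ → Restricts y ỹ → x =ᵖ y ≡ x̃ =ᵖ ỹ
  =ᵖ-restrict {x} {x̃} {y} {ỹ} x↦ y↦ =
    ⇔→≡ (⇔-trans (=ᵖ-true⇔≡ x y) (⇔-trans (≡-restrict x↦ y↦) (⇔-sym (=ᵖ-true⇔≡ x̃ ỹ))))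

  restrict : Vec ℕ n → Vec ℕ m
  restrict x = canon (lookup x ∘ e)

  restricts : ∀ {x} → x ∈ˡ Π n → SingletonsOnI x → Restricts x (restrict x)
  restricts x∈ x-singletons = record
    { x∈Π = x∈ ; x̃∈Π = canon-∈Π _ ; singletons = x-singletons ; kernel = canon-kernel _ }

  -- Indices in I get pairwise distinct labels below n; all others are labelled by y shifted past n.
  private
    lift : Vec ℕ m → Fin n → ℕ
    lift y j with j ∈? I
    ... | yes _  = toℕ j
    ... | no j∉I = n ℕ.+ lookup y (proj₁ (e-onto j j∉I))

    lift-I : ∀ y {j} → j ∈ I → lift y j ≡ toℕ j
    lift-I y {j} j∈I with j ∈? I
    ... | yes _  = refl
    ... | no j∉I = ⊥-elim (j∉I j∈I)

    lift-e : ∀ y i → lift y (e i) ≡ n ℕ.+ lookup y i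
    lift-e y i with e i ∈? I
    ... | yes eᵢ∈I = ⊥-elim (e∉I i eᵢ∈I)
    ... | no eᵢ∉I  = cong (λ t → n ℕ.+ lookup y t) (e-injective (proj₂ (e-onto (e i) eᵢ∉I)))

    lift-singletons : ∀ y j → j ∈ I → ∀ k → lift y k ≡ lift y j → k ≡ j
    lift-singletons y j j∈I k lₖ≡lⱼ with k ∈? I
    ... | yes _ = Fin.toℕ-injective (trans lₖ≡lⱼ (lift-I y j∈I))
    ... | no _  = ⊥-elim (ℕ.<⇒≱ (Fin.toℕ<n j)
                    (subst (n ℕ.≤_) (trans lₖ≡lⱼ (lift-I y j∈I)) (ℕ.m≤m+n n _)))

    lift-e-kernel : ∀ y → SameKernel (lift y ∘ e) (lookup y)
    lift-e-kernel y i k = mk⇔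
      (λ lᵢ≡lₖ → ℕ.+-cancelˡ-≡ n _ _ (trans (sym (lift-e y i)) (trans lᵢ≡lₖ (lift-e y k))))
      (λ yᵢ≡yₖ → trans (lift-e y i) (trans (cong (n ℕ.+_) yᵢ≡yₖ) (sym (lift-e y k))))

  restrict-onto : ∀ {ỹ} → ỹ ∈ˡ Π m → ∃ λ y → y ∈ˡ Π n × SingletonsOnI y × restrict y ≡ ỹ
  restrict-onto {ỹ} ỹ∈ = y , canon-∈Π _ , y-singletons ,
    Π-kernel-injective (canon-∈Π _) ỹ∈ (λ i k → Equivalence.to (y↦ỹ i k)) (λ i k → Equivalence.from (y↦ỹ i k))
    where
    y : Vec ℕ n
    y = canon (lift ỹ)
    y-singletons : SingletonsOnI y
    y-singletons j j∈I k yₖ≡yⱼ = lift-singletons ỹ j j∈I k (Equivalence.to (canon-kernel (lift ỹ) k j) yₖ≡yⱼ)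
    y↦ỹ : SameKernel (lookup (restrict y)) (lookup ỹ)
    y↦ỹ i k = ⇔-trans (canon-kernel _ i k) (⇔-trans (canon-kernel (lift ỹ) (e i) (e k)) (lift-e-kernel ỹ i k))

  module _ {c ℓ : Level} (R : CommutativeRing c ℓ) where
    open CommutativeRing R using (Carrier; _≈_; -‿cong) renaming (refl to ≈-refl)

    Σᴿ-restrict : (p : Vec ℕ n → Bool) (p̃ : Vec ℕ m → Bool) {g : Vec ℕ n → Carrier} {h : Vec ℕ m → Carrier} →
      (∀ {x} → x ∈ˡ Π n → p x ≡ true → SingletonsOnI x) →
      (∀ {x} → x ∈ˡ Π n → SingletonsOnI x → p x ≡ p̃ (restrict x)) →
      (∀ {x} → x ∈ˡ Π n → SingletonsOnI x → p x ≡ true → g x ≈ h (restrict x)) →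
      Σᴿ R (map g (filter (λ x → p x Bool.≟ true) (Π n))) ≈ Σᴿ R (map h (filter (λ y → p̃ y Bool.≟ true) (Π m)))
    Σᴿ-restrict p p̃ {g} {h} p⇒singletons p≡p̃ g≈h = Σᴿ-reindex R restrict
      (Unique.filter⁺ _ (Π-unique n)) (Unique.filter⁺ _ (Π-unique m)) injective into onto g≈h′
      where
      source : List (Vec ℕ n)
      source = filter (λ x → p x Bool.≟ true) (Π n)
      target : List (Vec ℕ m)
      target = filter (λ y → p̃ y Bool.≟ true) (Π m)
      member : ∀ {x} → x ∈ˡ source → Restricts x (restrict x) × p x ≡ true
      member x∈ with ∈-filter⁻ _ x∈
      ... | x∈Π , px = restricts x∈Π (p⇒singletons x∈Π px) , px
      injective : ∀ {x y} → x ∈ˡ source → y ∈ˡ source → restrict x ≡ restrict y → x ≡ y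
      injective x∈ y∈ = Equivalence.from (≡-restrict (proj₁ (member x∈)) (proj₁ (member y∈)))
      into : ∀ {x} → x ∈ˡ source → restrict x ∈ˡ target
      into x∈ with member x∈
      ... | x↦ , px = ∈-filter⁺ _ (x̃∈Π x↦) (trans (sym (p≡p̃ (x∈Π x↦) (singletons x↦))) px)
      onto : ∀ {ỹ} → ỹ ∈ˡ target → ∃ λ x → x ∈ˡ source × restrict x ≡ ỹ
      onto ỹ∈ with ∈-filter⁻ _ ỹ∈
      ... | ỹ∈Π , p̃ỹ with restrict-onto ỹ∈Π
      ... | y , y∈ , y-singletons , refl = y , ∈-filter⁺ _ y∈ (trans (p≡p̃ y∈ y-singletons) p̃ỹ) , refl
      g≈h′ : ∀ {x} → x ∈ˡ source → g x ≈ h (restrict x)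
      g≈h′ x∈ with member x∈
      ... | x↦ , px = g≈h (x∈Π x↦) (singletons x↦) px

    μ-fuel-restrict : ∀ f {σ σ̃ τ τ̃} → Restricts σ σ̃ → Restricts τ τ̃ → μ-fuel R f σ τ ≈ μ-fuel R f σ̃ τ̃
    μ-fuel-restrict zero    _ _ = ≈-refl
    μ-fuel-restrict (suc f) {σ} {σ̃} {τ} {τ̃} σ↦ τ↦
      rewrite =ᵖ-restrict σ↦ τ↦ | ≤ᵖ-restrict σ↦ τ↦ with σ̃ =ᵖ τ̃ | σ̃ ≤ᵖ τ̃
    ... | true  | _     = ≈-refl
    ... | false | false = ≈-refl
    ... | false | true  =
      -‿cong (Σᴿ-restrict interval interval̃ interval⇒singletons interval-restrict μ-restrict-below)
      where
      interval : Vec ℕ n → Bool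
      interval x = (σ ≤ᵖ x) ∧ (x ≤ᵖ τ) ∧ not (x =ᵖ τ)
      interval̃ : Vec ℕ m → Bool
      interval̃ x̃ = (σ̃ ≤ᵖ x̃) ∧ (x̃ ≤ᵖ τ̃) ∧ not (x̃ =ᵖ τ̃)
      interval⇒singletons : ∀ {x} → x ∈ˡ Π n → interval x ≡ true → SingletonsOnI x
      interval⇒singletons {x} _ x-inside with Equivalence.to (∧-true⇔ {σ ≤ᵖ x}) x-inside
      ... | _ , rest = singletons-antitone {x} {τ}
        (Equivalence.to (≤ᵖ-true⇔Refines x τ) (proj₁ (Equivalence.to ∧-true⇔ rest))) (singletons τ↦)
      interval-restrict : ∀ {x} → x ∈ˡ Π n → SingletonsOnI x → interval x ≡ interval̃ (restrict x)
      interval-restrict {x} x∈ x-singletons =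
        cong₂ _∧_ (≤ᵖ-restrict σ↦ x↦) (cong₂ _∧_ (≤ᵖ-restrict x↦ τ↦) (cong not (=ᵖ-restrict x↦ τ↦)))
        where
        x↦ : Restricts x (restrict x)
        x↦ = restricts x∈ x-singletons
      μ-restrict-below : ∀ {x} → x ∈ˡ Π n → SingletonsOnI x → interval x ≡ true →
        μ-fuel R f σ x ≈ μ-fuel R f σ̃ (restrict x)
      μ-restrict-below x∈ x-singletons _ = μ-fuel-restrict f σ↦ (restricts x∈ x-singletons)

  module _ {r ℓr a ℓa u ℓu : Level} {R : CommutativeRing r ℓr} {P : NCProbabilitySpace {R = R} a ℓa}
           (E : ExchangeabilitySystem P u ℓu) where
    open ExchangeabilitySystem E
    open CommutativeRing R using (_≈_) renaming (trans to ≈-trans)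
    private
      module A = UnitalAlgebra (NCProbabilitySpace.algebra P)
      module U = UnitalAlgebra 𝒰

    φ-restrict : (X : Fin n → A.Carrier) → (∀ j → j ∈ I → X j A.≈ A.1#) → ∀ σ →
      φ[ E ] σ X ≈ φ[ E ] (restrict σ) (X ∘ e)
    φ-restrict X X-units σ = ≈-trans
      (IsUnitalLinearFunctional.cong φ̃-isUnitalLinearFunctional (prod-drop-units 𝒰 n m _ e e-increasing off-image))
      (φ̃-relabel E (λ i j → ⇔-sym (canon-kernel (lookup σ ∘ e) i j)) (X ∘ e))
      where
      off-image : ∀ j → (∀ i → e i ≢ j) → ι (lookup σ j) (X j) U.≈ U.1#
      off-image j j∉e with j ∈? I
      ... | yes j∈I = U.trans (⟦⟧-cong (X-units j j∈I)) 1#-homo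
        where open IsRingMonomorphism (IsEmbedding.isRingMonomorphism (ι-isEmbedding (lookup σ j)))
      ... | no j∉I  = ⊥-elim (j∉e (proj₁ (e-onto j j∉I)) (proj₂ (e-onto j j∉I)))

lemma3p8 : ∀ {r ℓr a ℓa u ℓu} {R : CommutativeRing r ℓr} {P : NCProbabilitySpace {R = R} a ℓa}
    (E : ExchangeabilitySystem P u ℓu)
    (n : ℕ) (X : Fin n → UnitalAlgebra.Carrier (NCProbabilitySpace.algebra P)) (I : Subset n) →
    (∀ j → j ∈ I → UnitalAlgebra._≈_ (NCProbabilitySpace.algebra P) (X j) (UnitalAlgebra.1# (NCProbabilitySpace.algebra P))) →
    (π : Vec ℕ n) → π ∈ˡ Π n →
    (∀ j → j ∈ I → ∀ k → lookup π k ≡ lookup π j → k ≡ j) →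
    (m : ℕ) (e : Fin m → Fin n) →
    (∀ i k → i < k → e i < e k) →
    (∀ i → e i ∉ I) →
    (∀ j → j ∉ I → ∃ λ i → e i ≡ j) →
    (π̃ : Vec ℕ m) → π̃ ∈ˡ Π m →
    (∀ i k → (lookup π̃ i ≡ lookup π̃ k) ⇔ (lookup π (e i) ≡ lookup π (e k))) →
    CommutativeRing._≈_ R (K[ E ] π X) (K[ E ] π̃ (λ i → X (e i)))
lemma3p8 {R = R} E n X I X-units π π∈ π-singletons m e e-increasing e∉I e-onto π̃ π̃∈ π̃-kernel =
  Σᴿ-restrict R (_≤ᵖ π) (_≤ᵖ π̃)
    (λ {σ} _ σ≤π → singletons-antitone {σ} {π} (Equivalence.to (≤ᵖ-true⇔Refines σ π) σ≤π) π-singletons)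
    (λ σ∈ σ-singletons → ≤ᵖ-restrict (restricts σ∈ σ-singletons) π↦π̃)
    (λ {σ} σ∈ σ-singletons σ≤π → *-cong (φ-restrict E X X-units σ) (μ-restrict σ∈ σ-singletons σ≤π))
  where
  open Restriction e I e-increasing e∉I e-onto
  open CommutativeRing R using (_≈_; *-cong) renaming (trans to ≈-trans)

  π↦π̃ : Restricts π π̃
  π↦π̃ = record { x∈Π = π∈ ; x̃∈Π = π̃∈ ; singletons = π-singletons ; kernel = π̃-kernel }

  μ-restrict : ∀ {σ} → σ ∈ˡ Π n → SingletonsOnI σ → σ ≤ᵖ π ≡ true → μ R σ π ≈ μ R (restrict σ) π̃
  μ-restrict {σ} σ∈ σ-singletons σ≤π = ≈-trans (μ-fuel-restrict R (suc n) σ↦ π↦π̃)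
    (μ-fuel≈μ R (suc n) (ℕ.s≤s m≤n) (canon-∈Π _) π̃∈
      (refines-restrict σ↦ π↦π̃ (Equivalence.to (≤ᵖ-true⇔Refines σ π) σ≤π)))
    where
    σ↦ : Restricts σ (restrict σ)
    σ↦ = restricts σ∈ σ-singletons
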